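{- Let $\mathcal{I}$ be an instance of Popular Matching with Weighted Voters on a bipartite graph $G=(A\cup B,E)$ with $w(a)=c>3$ for all $a\in A$ and $w(b)=1$ for all $b\in B$. Then every popular matching $M$ of $\mathcal{I}$ is also popular in the instance $\mathcal{I}'$ obtained from $\mathcal{I}$ by setting $w(b)=0$ for all $b\in B$ (all else unchanged).
   Context: An instance consists of a bipartite graph $G=(A\cup B,E)$, for each vertex a strict preference order over its neighbours, and vertex weights $w:A\cup B\to\mathbb{Q}_{\ge0}$; every vertex prefers being matched to being unmatched. For matchings $M,M'$, let $V^+(M,M')$ be the set of vertices preferring their situation in $M$ to that in $M'$, and $\Delta_w(M,M')=\sum_{v\in V^+(M,M')}w(v)-\sum_{v\in V^+(M',M)}w(v)$. A matching $M$ is popular if $\Delta_w(M,M')\ge0$ for every matching $M'$. -}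

module Defs where

open import Data.Nat using (ℕ; _<ᵇ_)
open import Data.Bool using (Bool; true; false; if_then_else_)
open import Data.Fin using (Fin)
open import Data.List using (List; foldr; map; allFin)
open import Data.Maybe using (Maybe; just; nothing)
open import Data.Rational using (ℚ; 0ℚ; _+_; _-_; _≤_)
open import Relation.Binary.PropositionalEquality using (_≡_; _≢_)

-- A bipartite graph G = (A ∪ B, E) with A = Fin nA, B = Fin nB, together with
-- strict preference orders: each vertex ranks its neighbours by a natural
-- number (smaller rank = more preferred); distinct neighbours get distinct ranks.
record Instance : Set where
  field
    nA nB : ℕ
    E     : Fin nA → Fin nB → Bool
    rankA : Fin nA → Fin nB → ℕ
    rankB : Fin nB → Fin nA → ℕ
    strictA : ∀ a b b′ → E a b ≡ true → E a b′ ≡ true → b ≢ b′ → rankA a b ≢ rankA a b′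
    strictB : ∀ b a a′ → E a b ≡ true → E a′ b ≡ true → a ≢ a′ → rankB b a ≢ rankB b a′

open Instance public

record Matching (I : Instance) : Set where
  field
    mA : Fin (nA I) → Maybe (Fin (nB I))
    mB : Fin (nB I) → Maybe (Fin (nA I))
    consistent₁ : ∀ a b → mA a ≡ just b → mB b ≡ just a
    consistent₂ : ∀ a b → mB b ≡ just a → mA a ≡ just b
    inE : ∀ a b → mA a ≡ just b → E I a b ≡ true

open Matching public

prefers : {X : Set} → (X → ℕ) → Maybe X → Maybe X → Bool
prefers r (just x) nothing  = true
prefers r (just x) (just y) = r x <ᵇ r y
prefers r nothing  _        = false

V⁺A : {I : Instance} → Matching I → Matching I → Fin (nA I) → Bool
V⁺A {I} M M′ a = prefers (rankA I a) (mA M a) (mA M′ a)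

V⁺B : {I : Instance} → Matching I → Matching I → Fin (nB I) → Bool
V⁺B {I} M M′ b = prefers (rankB I b) (mB M b) (mB M′ b)

weightOf : {n : ℕ} → (Fin n → ℚ) → (Fin n → Bool) → ℚ
weightOf {n} w S = foldr _+_ 0ℚ (map (λ v → if S v then w v else 0ℚ) (allFin n))

Δ : (I : Instance) → (Fin (nA I) → ℚ) → (Fin (nB I) → ℚ) → Matching I → Matching I → ℚ
Δ I wA wB M M′ =
  (weightOf wA (V⁺A M M′) + weightOf wB (V⁺B M M′))
  - (weightOf wA (V⁺A M′ M) + weightOf wB (V⁺B M′ M))

Popular : (I : Instance) → (Fin (nA I) → ℚ) → (Fin (nB I) → ℚ) → Matching I → Set
Popular I wA wB M = ∀ (M′ : Matching I) → 0ℚ ≤ Δ I wA wB M M′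

-- Popularity of M for the weights (c, 1) rules out two local changes.  Matching a to a
-- neighbour b that a prefers to M(a), when b is unmatched in M, gains the votes of a and b
-- (weight c + 1) and loses at most that of M(a) (weight 1).  If instead b = M(a′) and a′ is
-- simultaneously moved to a neighbour b′ it prefers to b, the change gains a and a′ (weight 2c)
-- and loses at most M(b′), b, b′ and M(a) (weight c + 3): a net gain exactly because c > 3.
-- Hence every a preferring a rival M′ to M is M′-matched to some b = M(a′) with a′ preferring
-- M to M′, and a = M′(M(a′)) is determined by a′.  So on the A side at least as many vertices
-- prefer M as prefer M′, which is all that counts once B has weight 0.

module Submission where

open import Defs
open import Data.Empty using (⊥-elim)
open import Data.Bool using (Bool; true; false; T; if_then_else_)
open import Data.Fin using (Fin)
open import Data.Fin.Properties using (_≟_)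
open import Data.Integer using (+_)
open import Data.List using (List; []; _∷_; length; filter; allFin; foldr; map; mapMaybe; fromMaybe)
open import Data.List.Membership.Propositional using (_∈_)
open import Data.List.Membership.Propositional.Properties using (∈-filter⁺; ∈-filter⁻; ∈-allFin)
open import Data.List.Properties using (length-removeAt′; length-mapMaybe)
open import Data.List.Relation.Binary.Subset.Propositional using (_⊆_)
open import Data.List.Relation.Unary.All as All using ([]; _∷_)
open import Data.List.Relation.Unary.AllPairs using ([]; _∷_)
open import Data.List.Relation.Unary.Any as Any using (here; there; _─_)
import Data.List.Relation.Unary.Any.Properties as Anyₚ
open import Data.List.Relation.Unary.Unique.Propositional using (Unique)
open import Data.List.Relation.Unary.Unique.Propositional.Properties using (filter⁺; allFin⁺)
open import Data.Maybe using (Maybe; just; nothing; _>>=_)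
open import Data.Maybe.Properties using (just-injective) renaming (≡-dec to ≡-decMaybe)
open import Data.Maybe.Relation.Unary.Any as MaybeAny using ()
open import Data.Nat as ℕ using (ℕ; zero; suc; z≤n; s≤s)
open import Data.Nat.Properties as ℕ using (<ᵇ⇒<; <⇒<ᵇ; <-cmp)
open import Data.Product using (_×_; _,_; proj₂; ∃)
open import Data.Rational using (ℚ; 0ℚ; 1ℚ; _+_; _-_; -_; _≤_; _<_; _/_)
open import Data.Rational.Properties as ℚ using ()
open import Data.Sum using (_⊎_; inj₁; inj₂)
open import Data.Unit using (tt)
open import Function using (_∘_)
open import Relation.Binary using (DecidableEquality; tri<; tri≈; tri>)
open import Relation.Binary.PropositionalEquality
open import Relation.Nullary using (¬_; does; yes; no; contradiction)
open import Relation.Nullary.Decidable using (T?; dec-true; dec-false)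
open import Algebra.Properties.Monoid.Mult ℚ.+-0-monoid using () renaming (_×_ to _·_)

private
  variable
    A : Set
    n k : ℕ

∈-─⁺ : ∀ {x y : A} {ys} (x∈ys : x ∈ ys) → y ∈ ys → y ≢ x → y ∈ (ys ─ x∈ys)
∈-─⁺ (here refl) (here refl) y≢x = contradiction refl y≢x
∈-─⁺ (here refl) (there y∈ys) _  = y∈ys
∈-─⁺ (there _)   (here refl)  _  = here refl
∈-─⁺ (there x∈ys) (there y∈ys) y≢x = there (∈-─⁺ x∈ys y∈ys y≢x)

length-mono-⊆ : {xs ys : List A} → Unique xs → xs ⊆ ys → length xs ℕ.≤ length ys
length-mono-⊆ {xs = []} _ _ = z≤n
length-mono-⊆ {xs = x ∷ xs} {ys} (x∉xs ∷ xs!) xs⊆ys =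
  subst (suc (length xs) ℕ.≤_) (sym (length-removeAt′ ys (Any.index x∈ys)))
    (s≤s (length-mono-⊆ xs! λ y∈xs → ∈-─⁺ x∈ys (xs⊆ys (there y∈xs)) (All.lookup x∉xs y∈xs ∘ sym)))
  where
  x∈ys = xs⊆ys (here refl)

∈-mapMaybe⁺ : ∀ {B : Set} {x : A} {y : B} {xs} (g : A → Maybe B) →
  x ∈ xs → g x ≡ just y → y ∈ mapMaybe g xs
∈-mapMaybe⁺ {y = y} {xs} g x∈xs gx≡y = Anyₚ.mapMaybe⁺ g xs (Anyₚ.map⁺ (Any.map y∈g x∈xs))
  where
  y∈g : ∀ {x′} → _ ≡ x′ → MaybeAny.Any (y ≡_) (g x′)
  y∈g refl = subst (MaybeAny.Any (y ≡_)) (sym gx≡y) (MaybeAny.just refl)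

length-fromMaybe : (m : Maybe A) → length (fromMaybe m) ℕ.≤ 1
length-fromMaybe nothing  = z≤n
length-fromMaybe (just _) = s≤s z≤n

members : (Fin n → Bool) → List (Fin n)
members {n} S = filter (T? ∘ S) (allFin n)

count : (Fin n → Bool) → ℕ
count S = length (members S)

members-unique : (S : Fin n → Bool) → Unique (members S)
members-unique {n} S = filter⁺ (T? ∘ S) (allFin⁺ n)

∈-members⁺ : (S : Fin n → Bool) {v : Fin n} → T (S v) → v ∈ members S
∈-members⁺ S {v} = ∈-filter⁺ (T? ∘ S) (∈-allFin v)

∈-members⁻ : (S : Fin n → Bool) {v : Fin n} → v ∈ members S → T (S v)
∈-members⁻ {n} S = proj₂ ∘ ∈-filter⁻ (T? ∘ S) {xs = allFin n}

count-≤-length : (S : Fin n → Bool) {xs : List (Fin n)} → (∀ v → T (S v) → v ∈ xs) → count S ℕ.≤ length xs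
count-≤-length S S⊆xs = length-mono-⊆ (members-unique S) λ v∈S → S⊆xs _ (∈-members⁻ S v∈S)

length-≤-count : (S : Fin n → Bool) {xs : List (Fin n)} → Unique xs → (∀ {v} → v ∈ xs → T (S v)) →
  length xs ℕ.≤ count S
length-≤-count S xs! xs⊆S = length-mono-⊆ xs! (∈-members⁺ S ∘ xs⊆S)

count-≤-partialImage : (P : Fin n → Bool) (Q : Fin k → Bool) (g : Fin k → Maybe (Fin n)) →
  (∀ v → T (P v) → ∃ λ u → T (Q u) × g u ≡ just v) → count P ℕ.≤ count Q
count-≤-partialImage P Q g covered = ℕ.≤-trans
  (length-mono-⊆ (members-unique P) λ {v} v∈P → cover v (∈-members⁻ P v∈P))
  (length-mapMaybe g (members Q))
  where
  cover : ∀ v → T (P v) → v ∈ mapMaybe g (members Q)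
  cover v Pv with u , Qu , gu≡v ← covered v Pv = ∈-mapMaybe⁺ g (∈-members⁺ Q Qu) gu≡v

·-monoˡ-≤ : ∀ {x} → 0ℚ ≤ x → ∀ {m n} → m ℕ.≤ n → m · x ≤ n · x
·-monoˡ-≤ {x} 0≤x {zero} {n} _ = ·-nonNegative n
  where
  ·-nonNegative : ∀ n → 0ℚ ≤ n · x
  ·-nonNegative zero    = ℚ.≤-refl
  ·-nonNegative (suc n) = ℚ.+-mono-≤ 0≤x (·-nonNegative n)
·-monoˡ-≤ {x} 0≤x (s≤s m≤n) = ℚ.+-monoʳ-≤ x (·-monoˡ-≤ 0≤x m≤n)

·-zeroʳ : ∀ n → n · 0ℚ ≡ 0ℚ
·-zeroʳ zero    = refl
·-zeroʳ (suc n) = trans (ℚ.+-identityˡ (n · 0ℚ)) (·-zeroʳ n)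

p≤q⇒0≤q-p : ∀ {p q} → p ≤ q → 0ℚ ≤ q - p
p≤q⇒0≤q-p {p} {q} p≤q = subst (_≤ q - p) (ℚ.+-inverseʳ p) (ℚ.+-monoˡ-≤ (- p) p≤q)

0≤q-p⇒p≤q : ∀ {p q} → 0ℚ ≤ q - p → p ≤ q
0≤q-p⇒p≤q {p} {q} 0≤q-p = subst₂ _≤_ (ℚ.+-identityˡ p) q-p+p≡q (ℚ.+-monoˡ-≤ p 0≤q-p)
  where
  q-p+p≡q : q - p + p ≡ q
  q-p+p≡q = begin
    q - p + p     ≡⟨ ℚ.+-assoc q (- p) p ⟩
    q + (- p + p) ≡⟨ cong (λ r → q + r) (ℚ.+-inverseˡ p) ⟩
    q + 0ℚ        ≡⟨ ℚ.+-identityʳ q ⟩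
    q             ∎
    where open ≡-Reasoning

3<c⇒0<c : ∀ {c} → + 3 / 1 < c → 0ℚ < c
3<c⇒0<c = ℚ.<-trans (ℚ.positive⁻¹ (+ 3 / 1))

weightOf-const : (w : ℚ) (S : Fin n → Bool) → weightOf (λ _ → w) S ≡ count S · w
weightOf-const {n} w S = go (allFin n)
  where
  go : (xs : List (Fin n)) →
    foldr _+_ 0ℚ (map (λ v → if S v then w else 0ℚ) xs) ≡ length (filter (T? ∘ S) xs) · w
  go []       = refl
  go (x ∷ xs) with S x
  ... | true  = cong (λ r → w + r) (go xs)
  ... | false = trans (ℚ.+-identityˡ _) (go xs)

score : {I : Instance} → ℚ → ℚ → Matching I → Matching I → ℚ
score wA wB M N = count (V⁺A M N) · wA + count (V⁺B M N) · wB

Δ-const : (I : Instance) (wA wB : ℚ) (M N : Matching I) →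
  Δ I (λ _ → wA) (λ _ → wB) M N ≡ score wA wB M N - score wA wB N M
Δ-const I wA wB M N
  rewrite weightOf-const wA (V⁺A M N) | weightOf-const wB (V⁺B M N)
        | weightOf-const wA (V⁺A N M) | weightOf-const wB (V⁺B N M) = refl

score-zeroʳ : {I : Instance} (w : ℚ) (M N : Matching I) → score w 0ℚ M N ≡ count (V⁺A M N) · w
score-zeroʳ w M N = trans (cong (λ r → count (V⁺A M N) · w + r) (·-zeroʳ (count (V⁺B M N))))
                          (ℚ.+-identityʳ (count (V⁺A M N) · w))

popular⇒score-≤ : {I : Instance} {wA wB : ℚ} {M : Matching I} → Popular I (λ _ → wA) (λ _ → wB) M →
  ∀ N → score wA wB N M ≤ score wA wB M N
popular⇒score-≤ {I} {wA} {wB} {M} popular N = 0≤q-p⇒p≤q (subst (0ℚ ≤_) (Δ-const I wA wB M N) (popular N))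

module _ {X : Set} (r : X → ℕ) where

  prefers-irrefl : ∀ m → ¬ T (prefers r m m)
  prefers-irrefl (just x) h = ℕ.<-irrefl refl (<ᵇ⇒< (r x) (r x) h)

  prefers-asym : ∀ {m m′} → T (prefers r m m′) → ¬ T (prefers r m′ m)
  prefers-asym {just x} {just y} h h′ = ℕ.<-asym (<ᵇ⇒< (r x) (r y) h) (<ᵇ⇒< (r y) (r x) h′)

  prefers⇒≢ : ∀ {m m′} → T (prefers r m m′) → m ≢ m′
  prefers⇒≢ {m} h refl = prefers-irrefl m h

  prefers-connex : ∀ {x y} → r x ≢ r y → ¬ T (prefers r (just x) (just y)) → T (prefers r (just y) (just x))
  prefers-connex {x} {y} rx≢ry ¬x≻y with <-cmp (r x) (r y)
  ... | tri< rx<ry _ _ = contradiction (<⇒<ᵇ rx<ry) ¬x≻y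
  ... | tri≈ _ rx≡ry _ = contradiction rx≡ry rx≢ry
  ... | tri> _ _ ry<rx = <⇒<ᵇ ry<rx

module _ {I : Instance} (M N : Matching I) where

  V⁺A-asym : ∀ {v} → T (V⁺A M N v) → ¬ T (V⁺A N M v)
  V⁺A-asym {v} = prefers-asym (rankA I v) {mA M v} {mA N v}

  V⁺A⇒≢ : ∀ {v} → T (V⁺A M N v) → mA M v ≢ mA N v
  V⁺A⇒≢ {v} = prefers⇒≢ (rankA I v) {mA M v} {mA N v}

  V⁺B⇒≢ : ∀ {u} → T (V⁺B M N u) → mB M u ≢ mB N u
  V⁺B⇒≢ {u} = prefers⇒≢ (rankB I u) {mB M u} {mB N u}

PrefersToPartner : {I : Instance} → Matching I → Fin (nA I) → Fin (nB I) → Set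
PrefersToPartner {I} M a b = T (prefers (rankA I a) (just b) (mA M a))

prefersToPartner⇒≢ : {I : Instance} (M : Matching I) {a : Fin (nA I)} {b : Fin (nB I)} →
  PrefersToPartner M a b → mB M b ≢ just a
prefersToPartner⇒≢ {I} M {a} {b} a≻M Mb≡a =
  prefers-irrefl (rankA I a) (just b) (subst (T ∘ prefers (rankA I a) (just b)) (consistent₂ M a b Mb≡a) a≻M)

module _ {I : Instance} (M : Matching I) where

  mA-injective : ∀ {v v′ b} → mA M v ≡ just b → mA M v′ ≡ just b → v ≡ v′
  mA-injective {v} {v′} {b} Mv≡b Mv′≡b =
    just-injective (trans (sym (consistent₁ M v b Mv≡b)) (consistent₁ M v′ b Mv′≡b))

  mB-injective : ∀ {u u′ a} → mB M u ≡ just a → mB M u′ ≡ just a → u ≡ u′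
  mB-injective {u} {u′} {a} Mu≡a Mu′≡a =
    just-injective (trans (sym (consistent₂ M a u Mu≡a)) (consistent₂ M a u′ Mu′≡a))

≢-split : DecidableEquality A → ∀ {x y z : A} → x ≢ z → x ≢ y ⊎ y ≢ z
≢-split _≟_ {x} {y} x≢z with x ≟ y
... | yes refl = inj₂ x≢z
... | no x≢y   = inj₁ x≢y

_≟ₘ_ : DecidableEquality (Maybe (Fin n))
_≟ₘ_ = ≡-decMaybe _≟_

rematch : (Fin n → Maybe (Fin k)) → Fin n → Fin k → Fin n → Maybe (Fin k)
rematch m x y v = if does (v ≟ x) then just y else if does (m v ≟ₘ just y) then nothing else m v

module _ (m : Fin n → Maybe (Fin k)) (x : Fin n) (y : Fin k) where

  rematch-here : rematch m x y x ≡ just y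
  rematch-here rewrite dec-true (x ≟ x) refl = refl

  rematch-elsewhere : ∀ {v} → v ≢ x → m v ≢ just y → rematch m x y v ≡ m v
  rematch-elsewhere {v} v≢x mv≢y rewrite dec-false (v ≟ x) v≢x | dec-false (m v ≟ₘ just y) mv≢y = refl

  rematch-changed : ∀ {v} → m v ≢ rematch m x y v → v ≡ x ⊎ m v ≡ just y
  rematch-changed {v} changed with v ≟ x | m v ≟ₘ just y
  ... | yes v≡x | _        = inj₁ v≡x
  ... | no _    | yes mv≡y = inj₂ mv≡y
  ... | no _    | no _     = contradiction refl changed

  rematch-just⁻ : ∀ {v u} → rematch m x y v ≡ just u → v ≡ x × u ≡ y ⊎ v ≢ x × m v ≡ just u × u ≢ y
  rematch-just⁻ {v} {u} h with v ≟ x | m v ≟ₘ just y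
  ... | yes v≡x | _        = inj₁ (v≡x , sym (just-injective h))
  ... | no _    | yes _    = contradiction h λ ()
  ... | no v≢x  | no mv≢y  = inj₂ (v≢x , h , λ { refl → mv≢y h })

rematch-partners : (m : Fin n → Maybe (Fin k)) (m′ : Fin k → Maybe (Fin n)) →
  (∀ v u → m v ≡ just u → m′ u ≡ just v) → ∀ x y v u → rematch m x y v ≡ just u → rematch m′ y x u ≡ just v
rematch-partners m m′ partners x y v u h with rematch-just⁻ m x y {v} {u} h
... | inj₁ (refl , refl) = rematch-here m′ y x
... | inj₂ (v≢x , mv≡u , u≢y) = trans (rematch-elsewhere m′ y x u≢y m′u≢x) m′u≡v
  where
  m′u≡v = partners v u mv≡u
  m′u≢x : m′ u ≢ just x
  m′u≢x m′u≡x = v≢x (just-injective (trans (sym m′u≡v) m′u≡x))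

addEdge : {I : Instance} (M : Matching I) (a : Fin (nA I)) (b : Fin (nB I)) → E I a b ≡ true → Matching I
mA (addEdge M a b _) = rematch (mA M) a b
mB (addEdge M a b _) = rematch (mB M) b a
consistent₁ (addEdge M a b _) v u = rematch-partners (mA M) (mB M) (consistent₁ M) a b v u
consistent₂ (addEdge M a b _) v u = rematch-partners (mB M) (mA M) (λ u v → consistent₂ M v u) b a u v
inE (addEdge M a b e) v u h with rematch-just⁻ (mA M) a b {v} h
... | inj₁ (refl , refl) = e
... | inj₂ (_ , mv≡u , _) = inE M v u mv≡u

module _ {I : Instance} (M : Matching I) {a a′ : Fin (nA I)} {b b′ : Fin (nB I)}
         (eab : E I a b ≡ true) (eab′ : E I a′ b′ ≡ true) (Mb≡a′ : mB M b ≡ just a′) where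

  private
    N₁ = addEdge M a b eab

  addEdge²-changedA : ∀ {v} → mA M v ≢ mA (addEdge N₁ a′ b′ eab′) v → v ∈ a ∷ a′ ∷ fromMaybe (mB M b′)
  addEdge²-changedA {v} changed with ≢-split _≟ₘ_ {y = mA N₁ v} changed
  ... | inj₁ changed₁ with rematch-changed (mA M) a b {v} changed₁
  ...   | inj₁ refl = here refl
  ...   | inj₂ Mv≡b with refl ← mA-injective M Mv≡b (consistent₂ M a′ b Mb≡a′) = there (here refl)
  addEdge²-changedA {v} _ | inj₂ changed₂ with rematch-changed (mA N₁) a′ b′ {v} changed₂
  ...   | inj₁ refl = there (here refl)
  ...   | inj₂ N₁v≡b′ with rematch-just⁻ (mA M) a b {v} N₁v≡b′
  ...     | inj₁ (refl , _) = here refl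
  ...     | inj₂ (_ , Mv≡b′ , _) rewrite consistent₁ M v b′ Mv≡b′ = there (there (here refl))

  addEdge²-changedB : ∀ {u} → mB M u ≢ mB (addEdge N₁ a′ b′ eab′) u → u ∈ b ∷ b′ ∷ fromMaybe (mA M a)
  addEdge²-changedB {u} changed with ≢-split _≟ₘ_ {y = mB N₁ u} changed
  ... | inj₁ changed₁ with rematch-changed (mB M) b a {u} changed₁
  ...   | inj₁ refl = here refl
  ...   | inj₂ Mu≡a rewrite consistent₂ M a u Mu≡a = there (there (here refl))
  addEdge²-changedB {u} _ | inj₂ changed₂ with rematch-changed (mB N₁) b′ a′ {u} changed₂
  ...   | inj₁ refl = there (here refl)
  ...   | inj₂ N₁u≡a′ with rematch-just⁻ (mB M) b a {u} N₁u≡a′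
  ...     | inj₁ (refl , _) = here refl
  ...     | inj₂ (_ , Mu≡a′ , _) with refl ← mB-injective M Mu≡a′ Mb≡a′ = here refl

module _ {I : Instance} {c : ℚ} {M : Matching I} (popular : Popular I (λ _ → c) (λ _ → 1ℚ) M) where

  private
    no-improvement : ∀ N → ¬ (score c 1ℚ M N < score c 1ℚ N M)
    no-improvement N M<N = ℚ.<-irrefl refl (ℚ.<-≤-trans M<N (popular⇒score-≤ {M = M} popular N))

  wanted⇒matched : 0ℚ < c → ∀ {a b} → E I a b ≡ true → PrefersToPartner M a b → mB M b ≢ nothing
  wanted⇒matched 0<c {a} {b} eab a≻M b-free = no-improvement N (begin-strict
    score c 1ℚ M N  ≤⟨ ℚ.+-mono-≤ (·-monoˡ-≤ 0≤c A-votes) (·-monoˡ-≤ 0≤1 B-votes) ⟩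
    0 · c + 1 · 1ℚ  <⟨ ℚ.+-monoˡ-< (1 · 1ℚ) (subst (0ℚ <_) (sym (ℚ.+-identityʳ c)) 0<c) ⟩
    1 · c + 1 · 1ℚ  ≤⟨ ℚ.+-mono-≤ (·-monoˡ-≤ 0≤c A-votes-N) (·-monoˡ-≤ 0≤1 B-votes-N) ⟩
    score c 1ℚ N M  ∎)
    where
    open ℚ.≤-Reasoning
    0≤c = ℚ.<⇒≤ 0<c
    0≤1 = ℚ.nonNegative⁻¹ 1ℚ
    N = addEdge M a b eab
    a-votes-N : T (V⁺A N M a)
    a-votes-N = subst (λ z → T (prefers (rankA I a) z (mA M a))) (sym (rematch-here (mA M) a b)) a≻M
    b-votes-N : T (V⁺B N M b)
    b-votes-N = subst₂ (λ z z′ → T (prefers (rankB I b) z z′)) (sym (rematch-here (mB M) b a)) (sym b-free) tt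
    A-voter : ∀ v → T (V⁺A M N v) → v ∈ []
    A-voter v h with rematch-changed (mA M) a b {v} (V⁺A⇒≢ M N h)
    ... | inj₁ refl = contradiction h (V⁺A-asym N M a-votes-N)
    ... | inj₂ Mv≡b = contradiction (trans (sym (consistent₁ M v b Mv≡b)) b-free) λ ()
    B-voter : ∀ u → T (V⁺B M N u) → u ∈ fromMaybe (mA M a)
    B-voter u h with rematch-changed (mB M) b a {u} (V⁺B⇒≢ M N h)
    ... | inj₁ refl = contradiction (subst (λ z → T (prefers (rankB I b) z (mB N b))) b-free h) λ ()
    ... | inj₂ Mu≡a rewrite consistent₂ M a u Mu≡a = here refl
    A-votes = count-≤-length (V⁺A M N) A-voter
    B-votes = ℕ.≤-trans (count-≤-length (V⁺B M N) B-voter) (length-fromMaybe (mA M a))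
    A-votes-N = length-≤-count (V⁺A N M) {a ∷ []} ([] ∷ []) λ { (here refl) → a-votes-N }
    B-votes-N = length-≤-count (V⁺B N M) {b ∷ []} ([] ∷ []) λ { (here refl) → b-votes-N }

  wanted⇒partner-content : + 3 / 1 < c → ∀ {a b a′ b′} → E I a b ≡ true → PrefersToPartner M a b →
    mB M b ≡ just a′ → E I a′ b′ ≡ true → b′ ≢ b → ¬ T (prefers (rankA I a′) (just b′) (just b))
  wanted⇒partner-content 3<c {a} {b} {a′} {b′} eab a≻M Mb≡a′ eab′ b′≢b a′≻b =
    no-improvement N (begin-strict
    score c 1ℚ M N          ≤⟨ ℚ.+-mono-≤ (·-monoˡ-≤ 0≤c A-votes) (·-monoˡ-≤ 0≤1 B-votes) ⟩
    1 · c + 3 · 1ℚ          ≡⟨ cong (_+ + 3 / 1) (ℚ.+-identityʳ c) ⟩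
    c + + 3 / 1             <⟨ ℚ.+-monoʳ-< c 3<c ⟩
    c + c                   ≡⟨ c+c≡2c ⟩
    2 · c + 0 · 1ℚ          ≤⟨ ℚ.+-mono-≤ (·-monoˡ-≤ 0≤c A-votes-N) (·-monoˡ-≤ 0≤1 B-votes-N) ⟩
    score c 1ℚ N M          ∎)
    where
    open ℚ.≤-Reasoning
    0≤c = ℚ.<⇒≤ (3<c⇒0<c 3<c)
    0≤1 = ℚ.nonNegative⁻¹ 1ℚ
    c+c≡2c : c + c ≡ 2 · c + 0 · 1ℚ
    c+c≡2c = sym (trans (ℚ.+-identityʳ (2 · c)) (cong (λ r → c + r) (ℚ.+-identityʳ c)))
    Ma′≡b = consistent₂ M a′ b Mb≡a′
    a≢a′ : a ≢ a′
    a≢a′ refl = prefersToPartner⇒≢ M a≻M Mb≡a′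
    N₁ = addEdge M a b eab
    N = addEdge N₁ a′ b′ eab′
    N₁a≡b = rematch-here (mA M) a b
    Na≡b : mA N a ≡ just b
    Na≡b = trans (rematch-elsewhere (mA N₁) a′ b′ a≢a′ N₁a≢b′) N₁a≡b
      where
      N₁a≢b′ : mA N₁ a ≢ just b′
      N₁a≢b′ N₁a≡b′ = b′≢b (just-injective (trans (sym N₁a≡b′) N₁a≡b))
    a-votes-N : T (V⁺A N M a)
    a-votes-N = subst (λ z → T (prefers (rankA I a) z (mA M a))) (sym Na≡b) a≻M
    a′-votes-N : T (V⁺A N M a′)
    a′-votes-N = subst₂ (λ z z′ → T (prefers (rankA I a′) z z′))
                        (sym (rematch-here (mA N₁) a′ b′)) (sym Ma′≡b) a′≻b
    A-voter : ∀ v → T (V⁺A M N v) → v ∈ fromMaybe (mB M b′)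
    A-voter v h with addEdge²-changedA M eab eab′ Mb≡a′ (V⁺A⇒≢ M N h)
    ... | here refl          = contradiction h (V⁺A-asym N M a-votes-N)
    ... | there (here refl)  = contradiction h (V⁺A-asym N M a′-votes-N)
    ... | there (there v∈Mb′) = v∈Mb′
    B-voter : ∀ u → T (V⁺B M N u) → u ∈ b ∷ b′ ∷ fromMaybe (mA M a)
    B-voter u h = addEdge²-changedB M eab eab′ Mb≡a′ (V⁺B⇒≢ M N h)
    A-votes = ℕ.≤-trans (count-≤-length (V⁺A M N) A-voter) (length-fromMaybe (mB M b′))
    B-votes = ℕ.≤-trans (count-≤-length (V⁺B M N) B-voter) (s≤s (s≤s (length-fromMaybe (mA M a))))
    A-votes-N = length-≤-count (V⁺A N M) {a ∷ a′ ∷ []} ((a≢a′ ∷ []) ∷ [] ∷ [])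
      λ { (here refl) → a-votes-N ; (there (here refl)) → a′-votes-N }
    B-votes-N : 0 ℕ.≤ count (V⁺B N M)
    B-votes-N = z≤n

  V⁺A⇒partner-in-V⁺A : + 3 / 1 < c → (M′ : Matching I) → ∀ a → T (V⁺A M′ M a) →
    ∃ λ a′ → T (V⁺A M M′ a′) × (mA M a′ >>= mB M′) ≡ just a
  V⁺A⇒partner-in-V⁺A 3<c M′ a h with mA M′ a in M′a≡b
  ... | nothing = ⊥-elim h
  ... | just b with mB M b in Mb≡a′
  ...   | nothing = contradiction Mb≡a′ (wanted⇒matched (3<c⇒0<c 3<c) (inE M′ a b M′a≡b) h)
  ...   | just a′ = a′ , content , subst (λ z → (z >>= mB M′) ≡ just a) (sym Ma′≡b) (consistent₁ M′ a b M′a≡b)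
    where
    Ma′≡b = consistent₂ M a′ b Mb≡a′
    content : T (V⁺A M M′ a′)
    content with mA M′ a′ in M′a′≡b′
    ... | nothing rewrite Ma′≡b = tt
    ... | just b′ rewrite Ma′≡b = prefers-connex (rankA I a′)
          (strictA I a′ b′ b (inE M′ a′ b′ M′a′≡b′) (inE M a′ b Ma′≡b) b′≢b)
          (wanted⇒partner-content 3<c (inE M′ a b M′a≡b) h Mb≡a′ (inE M′ a′ b′ M′a′≡b′) b′≢b)
      where
      b′≢b : b′ ≢ b
      b′≢b refl = prefersToPartner⇒≢ M h (subst (λ z → mB M b ≡ just z) (mA-injective M′ M′a′≡b′ M′a≡b) Mb≡a′)

  count-V⁺A-≤ : + 3 / 1 < c → (M′ : Matching I) → count (V⁺A M′ M) ℕ.≤ count (V⁺A M M′)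
  count-V⁺A-≤ 3<c M′ =
    count-≤-partialImage (V⁺A M′ M) (V⁺A M M′) (λ a′ → mA M a′ >>= mB M′) (V⁺A⇒partner-in-V⁺A 3<c M′)

lemma4 : (I : Instance) (c : ℚ) → (+ 3 / 1) < c → (M : Matching I) →
    Popular I (λ _ → c) (λ _ → 1ℚ) M → Popular I (λ _ → c) (λ _ → 0ℚ) M
lemma4 I c 3<c M popular M′ = subst (0ℚ ≤_) (sym (Δ-const I c 0ℚ M M′)) (p≤q⇒0≤q-p (begin
  score c 0ℚ M′ M       ≡⟨ score-zeroʳ c M′ M ⟩
  count (V⁺A M′ M) · c  ≤⟨ ·-monoˡ-≤ (ℚ.<⇒≤ (3<c⇒0<c 3<c)) (count-V⁺A-≤ {M = M} popular 3<c M′) ⟩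
  count (V⁺A M M′) · c  ≡⟨ score-zeroʳ c M M′ ⟨
  score c 0ℚ M M′       ∎))
  where open ℚ.≤-Reasoning
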